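{- Let $k\geq 1$ and $n\geq1$. Every $k$-box path $\mu$ of size $n$ is of the form \[\mu=U^{a_{1}}D^{k}LD\,U^{a_{2}}D^{k}LD\cdots U^{a_{n-1}}D^{k}LD\,U^{a_{n}}D^{k}L\] for some positive integers $a_{1},\dots,a_{n}$. Conversely, any word $\mu$ of this form with positive integers $a_1,\dots,a_n$ satisfying $a_{1}+\cdots+a_{n}=(k+2)n-1$, and such that no prefix of $\mu$ contains fewer $U$s than the total number of $D$s and $L$s, is a $k$-box path of size $n$.
   Context: A skew Dyck path is a word $w$ over $\{U,D,L\}$ such that: $w$ contains neither $UL$ nor $LU$ as a contiguous subword; the number of $U$s equals the total number of $D$s and $L$s; and in every prefix the total number of $D$s and $L$s is at most the number of $U$s. Its semilength is its number of $U$s. A factor is a contiguous subword; $X^{m}$ denotes $m$ consecutive copies of $X$. For an integer $k\geq1$, a $k$-box path of size $n$ is a skew Dyck path of semilength $(k+2)n-1$ containing exactly $n$ occurrences of the factor $UD^{k}L$. -}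

module Defs where

open import Data.Nat using (ℕ; zero; suc; _+_; _*_; _∸_; _≤_)
open import Data.List using (List; []; _∷_; _++_; replicate; take; length; upTo; map; drop)
open import Data.Nat.ListAction using (sum)
open import Data.List.Relation.Unary.All using (All)
open import Data.Vec using (Vec; toList)
open import Data.Product using (_×_)
open import Relation.Binary.PropositionalEquality using (_≡_)
open import Data.Empty using (⊥)
open import Data.Unit using (⊤)

data Step : Set where
  U D L : Step

Word : Set
Word = List Step

#U #D #L : Word → ℕ
#U [] = 0
#U (U ∷ w) = suc (#U w)
#U (_ ∷ w) = #U w
#D [] = 0
#D (D ∷ w) = suc (#D w)
#D (_ ∷ w) = #D w
#L [] = 0
#L (L ∷ w) = suc (#L w)
#L (_ ∷ w) = #L w

NoULLU : Word → Set
NoULLU [] = ⊤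
NoULLU (U ∷ L ∷ w) = ⊥
NoULLU (L ∷ U ∷ w) = ⊥
NoULLU (_ ∷ w) = NoULLU w

PrefixCondition : Word → Set
PrefixCondition w = All (λ i → #D (take i w) + #L (take i w) ≤ #U (take i w)) (upTo (suc (length w)))

record SkewDyck (w : Word) : Set where
  field
    noULLU   : NoULLU w
    balanced : #U w ≡ #D w + #L w
    prefixes : PrefixCondition w

semilength : Word → ℕ
semilength = #U

isPrefix : Word → Word → ℕ
isPrefix [] _ = 1
isPrefix (_ ∷ _) [] = 0
isPrefix (U ∷ p) (U ∷ w) = isPrefix p w
isPrefix (D ∷ p) (D ∷ w) = isPrefix p w
isPrefix (L ∷ p) (L ∷ w) = isPrefix p w
isPrefix (_ ∷ _) (_ ∷ _) = 0

occurrences : Word → Word → ℕ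
occurrences f w = sum (map (λ i → isPrefix f (drop i w)) (upTo (suc (length w))))

box : ℕ → Word
box k = U ∷ replicate k D ++ L ∷ []

record KBoxPath (k n : ℕ) (w : Word) : Set where
  field
    skewDyck : SkewDyck w
    size     : semilength w ≡ (k + 2) * n ∸ 1
    boxes    : occurrences (box k) w ≡ n

boxWordL : ℕ → List ℕ → Word
boxWordL k [] = []
boxWordL k (a ∷ []) = replicate a U ++ replicate k D ++ L ∷ []
boxWordL k (a ∷ as@(_ ∷ _)) = replicate a U ++ replicate k D ++ L ∷ D ∷ boxWordL k as

boxWord : ∀ {n} → ℕ → Vec ℕ n → Word
boxWord k a = boxWordL k (toList a)

-- Occurrences of U D^k L cannot overlap, and as neither UL nor LU may occur, every box
-- except one ending the word is followed by a further D or L. So a word containing n boxes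
-- has at least (k+2)n − 1 down steps; balance and the semilength say it has exactly that
-- many, which leaves no room for other down steps: the word is a sequence of U-runs, each
-- closed by a box, with a single D between consecutive boxes. This direction does not use
-- the prefix condition. Conversely, the box count, the letter counts and the absence of UL
-- and LU are read off the explicit form, k ≥ 1 being what excludes the factor UL.
module Submission where

open import Defs
open import Data.Nat using (ℕ; _+_; _*_; _∸_; _≤_; _<_)
open import Data.Vec using (Vec; sum)
open import Data.Vec.Relation.Unary.All using (All)
open import Data.Product using (_×_; Σ; ∃-syntax)
open import Relation.Binary.PropositionalEquality using (_≡_)

open import Data.Nat using (zero; suc; z≤n; s≤s)
open import Data.Nat.Properties
  using (+-suc; +-comm; *-comm; +-cancelˡ-≤; suc-injective; <-trans; <-irrefl; n<1+n; ≤-reflexive)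
open import Data.List using ([]; _∷_; _++_; replicate; length; drop; applyUpTo)
open import Data.List.Properties using (map-upTo)
import Data.Nat.ListAction as List
open import Data.Vec using ([]; _∷_)
open import Data.Vec.Relation.Unary.All using ([]; _∷_)
open import Data.Product using (_,_)
open import Data.Sum using (_⊎_; inj₁; inj₂)
open import Data.Empty using (⊥; ⊥-elim)
open import Data.Unit using (tt)
open import Relation.Nullary using (¬_)
open import Relation.Binary.PropositionalEquality
  using (refl; sym; trans; cong; subst; module ≡-Reasoning)

downs : Word → ℕ
downs []      = 0
downs (U ∷ w) = downs w
downs (D ∷ w) = suc (downs w)
downs (L ∷ w) = suc (downs w)

downs≡#D+#L : ∀ w → downs w ≡ #D w + #L w
downs≡#D+#L []      = refl
downs≡#D+#L (U ∷ w) = downs≡#D+#L w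
downs≡#D+#L (D ∷ w) = cong suc (downs≡#D+#L w)
downs≡#D+#L (L ∷ w) = trans (cong suc (downs≡#D+#L w)) (sym (+-suc (#D w) (#L w)))

infixr 5 D^_L∷_

D^_L∷_ : ℕ → Word → Word
D^ j L∷ r = replicate j D ++ L ∷ r

#U-U^ : ∀ x w → #U (replicate x U ++ w) ≡ x + #U w
#U-U^ zero    w = refl
#U-U^ (suc x) w = cong suc (#U-U^ x w)

#U-D^L : ∀ j r → #U (D^ j L∷ r) ≡ #U r
#U-D^L zero    r = refl
#U-D^L (suc j) r = #U-D^L j r

downs-U^ : ∀ x w → downs (replicate x U ++ w) ≡ downs w
downs-U^ zero    w = refl
downs-U^ (suc x) w = downs-U^ x w

downs-D^L : ∀ j r → downs (D^ j L∷ r) ≡ suc j + downs r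
downs-D^L zero    r = refl
downs-D^L (suc j) r = cong suc (downs-D^L j r)

NoULLU-tail : ∀ c w → NoULLU (c ∷ w) → NoULLU w
NoULLU-tail U []      _  = tt
NoULLU-tail U (U ∷ w) ok = ok
NoULLU-tail U (D ∷ w) ok = ok
NoULLU-tail U (L ∷ w) ()
NoULLU-tail D w       ok = ok
NoULLU-tail L []      _  = tt
NoULLU-tail L (U ∷ w) ()
NoULLU-tail L (D ∷ w) ok = ok
NoULLU-tail L (L ∷ w) ok = ok

NoULLU-D^L⁻ : ∀ j r → NoULLU (D^ j L∷ r) → NoULLU (L ∷ r)
NoULLU-D^L⁻ zero    r ok = ok
NoULLU-D^L⁻ (suc j) r ok = NoULLU-D^L⁻ j r ok

NoULLU-D^L⁺ : ∀ j r → NoULLU (L ∷ r) → NoULLU (D^ j L∷ r)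
NoULLU-D^L⁺ zero    r ok = ok
NoULLU-D^L⁺ (suc j) r ok = NoULLU-D^L⁺ j r ok

NoULLU-U^ : ∀ x w → NoULLU (D ∷ w) → NoULLU (replicate x U ++ D ∷ w)
NoULLU-U^ zero          w ok = ok
NoULLU-U^ (suc zero)    w ok = ok
NoULLU-U^ (suc (suc x)) w ok = NoULLU-U^ (suc x) w ok

occurrences-∷ : ∀ f c w → occurrences f (c ∷ w) ≡ isPrefix f (c ∷ w) + occurrences f w
occurrences-∷ f c w = begin
  occurrences f (c ∷ w)
    ≡⟨ cong List.sum (map-upTo (prefixAt (c ∷ w)) (2 + length w)) ⟩
  isPrefix f (c ∷ w) + List.sum (applyUpTo (prefixAt w) (1 + length w))
    ≡⟨ cong (λ s → isPrefix f (c ∷ w) + List.sum s) (sym (map-upTo (prefixAt w) (1 + length w))) ⟩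
  isPrefix f (c ∷ w) + occurrences f w
    ∎
  where
  open ≡-Reasoning
  prefixAt : Word → ℕ → ℕ
  prefixAt v i = isPrefix f (drop i v)

#box : ℕ → Word → ℕ
#box k = occurrences (box k)

#box-letter : ∀ k c w → isPrefix (box k) (c ∷ w) ≡ 0 → #box k (c ∷ w) ≡ #box k w
#box-letter k c w noBox = trans (occurrences-∷ (box k) c w) (cong (_+ #box k w) noBox)

#box-D^L : ∀ k j r → #box k (D^ j L∷ r) ≡ #box k r
#box-D^L k zero    r = #box-letter k L r refl
#box-D^L k (suc j) r = trans (#box-letter k D (D^ j L∷ r) refl) (#box-D^L k j r)

isPrefix-D^L-self : ∀ j r → isPrefix (D^ j L∷ []) (D^ j L∷ r) ≡ 1
isPrefix-D^L-self zero    r = refl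
isPrefix-D^L-self (suc j) r = isPrefix-D^L-self j r

isPrefix-D^L-U : ∀ j w → isPrefix (D^ j L∷ []) (U ∷ w) ≡ 0
isPrefix-D^L-U zero    w = refl
isPrefix-D^L-U (suc j) w = refl

#box-boxed : ∀ k r → #box k (U ∷ D^ k L∷ r) ≡ suc (#box k r)
#box-boxed k r = begin
  #box k (U ∷ D^ k L∷ r)
    ≡⟨ occurrences-∷ (box k) U (D^ k L∷ r) ⟩
  isPrefix (D^ k L∷ []) (D^ k L∷ r) + #box k (D^ k L∷ r)
    ≡⟨ cong (_+ #box k (D^ k L∷ r)) (isPrefix-D^L-self k r) ⟩
  suc (#box k (D^ k L∷ r))
    ≡⟨ cong suc (#box-D^L k k r) ⟩
  suc (#box k r)
    ∎
  where open ≡-Reasoning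

#box-U^-boxed : ∀ k x r → #box k (replicate (suc x) U ++ D^ k L∷ r) ≡ suc (#box k r)
#box-U^-boxed k zero    r = #box-boxed k r
#box-U^-boxed k (suc x) r = trans (#box-letter k U _ (isPrefix-D^L-U k _)) (#box-U^-boxed k x r)

IsBoxWord : ℕ → ℕ → Word → Set
IsBoxWord k n w = ∃[ a ] (All (λ x → 1 ≤ x) a × w ≡ boxWord {n} k a)

U∷boxWord : ∀ {n} k x (as : Vec ℕ n) → U ∷ boxWord k (x ∷ as) ≡ boxWord k (suc x ∷ as)
U∷boxWord k x []      = refl
U∷boxWord k x (_ ∷ _) = refl

#U-boxWord : ∀ {n} k (a : Vec ℕ n) → #U (boxWord k a) ≡ sum a
#U-boxWord k []           = refl
#U-boxWord k (x ∷ [])     = trans (#U-U^ x _) (cong (x +_) (#U-D^L k []))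
#U-boxWord k (x ∷ y ∷ ys) =
  trans (#U-U^ x _) (cong (x +_) (trans (#U-D^L k _) (#U-boxWord k (y ∷ ys))))

downs-boxWord : ∀ {m} k (a : Vec ℕ (suc m)) → suc (downs (boxWord k a)) ≡ suc m * (2 + k)
downs-boxWord k (x ∷ [])     = cong suc (trans (downs-U^ x _) (downs-D^L k []))
downs-boxWord k (x ∷ y ∷ ys) =
  trans (cong suc (trans (downs-U^ x _) (downs-D^L k _)))
        (cong ((2 + k) +_) (downs-boxWord k (y ∷ ys)))

#box-boxWord : ∀ {n} k (a : Vec ℕ n) → All (λ x → 1 ≤ x) a → #box k (boxWord k a) ≡ n
#box-boxWord k []               []               = refl
#box-boxWord k (suc x ∷ [])     (s≤s z≤n ∷ [])   = #box-U^-boxed k x []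
#box-boxWord k (suc x ∷ y ∷ ys) (s≤s z≤n ∷ pos) =
  trans (#box-U^-boxed k x _)
        (cong suc (trans (#box-letter k D (boxWord k (y ∷ ys)) refl) (#box-boxWord k (y ∷ ys) pos)))

NoULLU-boxWord : ∀ {n} k (a : Vec ℕ n) → NoULLU (boxWord (suc k) a)
NoULLU-boxWord k []           = tt
NoULLU-boxWord k (x ∷ [])     = NoULLU-U^ x _ (NoULLU-D^L⁺ k [] tt)
NoULLU-boxWord k (x ∷ y ∷ ys) = NoULLU-U^ x _ (NoULLU-D^L⁺ k _ (NoULLU-boxWord k (y ∷ ys)))

¬NoULLU-L∷boxWord : ∀ {n} k y (ys : Vec ℕ n) → ¬ NoULLU (L ∷ boxWord k (suc y ∷ ys))
¬NoULLU-L∷boxWord k y []      ()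
¬NoULLU-L∷boxWord k y (_ ∷ _) ()

data Parse (k : ℕ) : Word → Set where
  []     : Parse k []
  boxed  : ∀ {r} → Parse k r → Parse k (U ∷ D^ k L∷ r)
  letter : ∀ c {r} → isPrefix (box k) (c ∷ r) ≡ 0 → Parse k r → Parse k (c ∷ r)

D^L-prefix? : ∀ j w → isPrefix (D^ j L∷ []) w ≡ 0 ⊎ ∃[ r ] w ≡ D^ j L∷ r
D^L-prefix? zero    []      = inj₁ refl
D^L-prefix? zero    (U ∷ w) = inj₁ refl
D^L-prefix? zero    (D ∷ w) = inj₁ refl
D^L-prefix? zero    (L ∷ w) = inj₂ (w , refl)
D^L-prefix? (suc j) []      = inj₁ refl
D^L-prefix? (suc j) (U ∷ w) = inj₁ refl
D^L-prefix? (suc j) (L ∷ w) = inj₁ refl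
D^L-prefix? (suc j) (D ∷ w) with D^L-prefix? j w
... | inj₁ noPrefix     = inj₁ noPrefix
... | inj₂ (r , refl)   = inj₂ (r , refl)

Parse-D^L⁻ : ∀ {k} j r → Parse k (D^ j L∷ r) → Parse k r
Parse-D^L⁻ zero    r (letter L _ p) = p
Parse-D^L⁻ (suc j) r (letter D _ p) = Parse-D^L⁻ j r p

-- The parse of the tail already contains the parse of what follows a box,
-- so no well-founded recursion is needed.
parse : ∀ k w → Parse k w
parse k []      = []
parse k (D ∷ w) = letter D refl (parse k w)
parse k (L ∷ w) = letter L refl (parse k w)
parse k (U ∷ w) with D^L-prefix? k w | parse k w
... | inj₁ noBox      | p = letter U noBox p
... | inj₂ (r , refl) | p = boxed (Parse-D^L⁻ k r p)

-- The period is written 2 + k, not k + 2, so that it computes to suc (suc k).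
mutual
  factorise : ∀ {k m w} → Parse k w → NoULLU w →
              #box k w ≡ suc m → downs w < suc m * (2 + k) → IsBoxWord k (suc m) w
  factorise [] _ () _
  factorise {k} (letter U {r} noBox p) ok count bound
    with factorise p (NoULLU-tail U r ok) (trans (sym (#box-letter k U r noBox)) count) bound
  ... | x ∷ as , _ ∷ pos , refl = suc x ∷ as , s≤s z≤n ∷ pos , U∷boxWord k x as
  factorise {k} (letter D {r} _ p) ok count bound =
    ⊥-elim (down-before-boxWord p (NoULLU-tail D r ok) (trans (sym (#box-letter k D r refl)) count) bound)
  factorise {k} (letter L {r} _ p) ok count bound =
    ⊥-elim (down-before-boxWord p (NoULLU-tail L r ok) (trans (sym (#box-letter k L r refl)) count) bound)
  factorise {k} {m} (boxed {r} p) ok count bound =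
    factorise-boxed p (NoULLU-D^L⁻ k r (NoULLU-tail U (D^ k L∷ r) ok))
      (suc-injective (trans (sym (#box-boxed k r)) count))
      (subst (_< suc m * (2 + k)) (downs-D^L k r) bound)

  down-before-boxWord : ∀ {k m r} → Parse k r → NoULLU r →
                        #box k r ≡ suc m → suc (downs r) < suc m * (2 + k) → ⊥
  down-before-boxWord p ok count bound with factorise p ok count (<-trans (n<1+n _) bound)
  ... | a , _ , refl = <-irrefl (downs-boxWord _ a) bound

  factorise-boxed : ∀ {k m r} → Parse k r → NoULLU (L ∷ r) →
                    #box k r ≡ m → suc k + downs r < suc m * (2 + k) →
                    IsBoxWord k (suc m) (U ∷ D^ k L∷ r)
  factorise-boxed [] _ refl _ = 1 ∷ [] , s≤s z≤n ∷ [] , refl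
  factorise-boxed (boxed _)      () _ _
  factorise-boxed (letter U _ _) () _ _
  factorise-boxed {k} {zero} (letter D _ _) _ _ bound with +-cancelˡ-≤ (2 + k) _ _ bound
  ... | ()
  factorise-boxed {k} {suc m} (letter D {r} noBox p) ok count bound
    with factorise p ok (trans (sym (#box-letter k D r noBox)) count)
                   (+-cancelˡ-≤ (2 + k) _ _ bound)
  ... | y ∷ ys , pos , refl = 1 ∷ y ∷ ys , s≤s z≤n ∷ pos , refl
  factorise-boxed {k} {zero} (letter L _ _) _ _ bound with +-cancelˡ-≤ (2 + k) _ _ bound
  ... | ()
  factorise-boxed {k} {suc m} (letter L {r} noBox p) ok count bound
    with factorise p (NoULLU-tail L r ok) (trans (sym (#box-letter k L r noBox)) count)
                   (+-cancelˡ-≤ (2 + k) _ _ bound)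
  ... | suc y ∷ ys , s≤s z≤n ∷ _ , refl = ⊥-elim (¬NoULLU-L∷boxWord k y ys ok)

lemma3p2 : (k n : ℕ) → 1 ≤ k → 1 ≤ n →
    ((μ : Word) → KBoxPath k n μ →
      ∃[ a ] (All (λ x → 1 ≤ x) a × μ ≡ boxWord {n} k a))
    × ((a : Vec ℕ n) → All (λ x → 1 ≤ x) a → sum a ≡ (k + 2) * n ∸ 1 →
      PrefixCondition (boxWord k a) → KBoxPath k n (boxWord k a))
lemma3p2 k@(suc k′) n@(suc m) (s≤s z≤n) (s≤s z≤n) = factorisation , boxPath
  where
  open ≡-Reasoning

  size-comm : (k + 2) * n ≡ n * (2 + k)
  size-comm = trans (*-comm (k + 2) n) (cong (n *_) (+-comm k 2))

  factorisation : (μ : Word) → KBoxPath k n μ → IsBoxWord k n μ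
  factorisation μ μ-path = factorise (parse k μ) noULLU boxes (≤-reflexive (cong suc downs≡))
    where
    open KBoxPath μ-path
    open SkewDyck skewDyck
    downs≡ : downs μ ≡ n * (2 + k) ∸ 1
    downs≡ = begin
      downs μ              ≡⟨ downs≡#D+#L μ ⟩
      #D μ + #L μ          ≡⟨ sym balanced ⟩
      #U μ                 ≡⟨ size ⟩
      (k + 2) * n ∸ 1      ≡⟨ cong (_∸ 1) size-comm ⟩
      n * (2 + k) ∸ 1      ∎

  boxPath : (a : Vec ℕ n) → All (λ x → 1 ≤ x) a → sum a ≡ (k + 2) * n ∸ 1 →
            PrefixCondition (boxWord k a) → KBoxPath k n (boxWord k a)
  boxPath a pos total prefixes = record
    { skewDyck = record { noULLU = NoULLU-boxWord k′ a ; balanced = balanced ; prefixes = prefixes }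
    ; size     = trans (#U-boxWord k a) total
    ; boxes    = #box-boxWord k a pos
    }
    where
    balanced : #U (boxWord k a) ≡ #D (boxWord k a) + #L (boxWord k a)
    balanced = begin
      #U (boxWord k a)                     ≡⟨ #U-boxWord k a ⟩
      sum a                                ≡⟨ total ⟩
      (k + 2) * n ∸ 1                      ≡⟨ cong (_∸ 1) size-comm ⟩
      n * (2 + k) ∸ 1                      ≡⟨ cong (_∸ 1) (sym (downs-boxWord k a)) ⟩
      downs (boxWord k a)                  ≡⟨ downs≡#D+#L (boxWord k a) ⟩
      #D (boxWord k a) + #L (boxWord k a)  ∎
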